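{- Let $F$ be a formula with $\mathsf{CL} \vdash \neg F$ but $\mathsf{IL} \nvdash \neg F$, and define for every formula $A$: $N_1(A) :\equiv A^G \vee F$ and $N_2(A) :\equiv A^G[F/\bot]$. Then each of $N_1$, $N_2$: (1) does not translate into $\mathsf{NF}$ in $\mathsf{IL}$, i.e. there is a formula $A$ such that no $B \in \mathsf{NF}$ satisfies $\mathsf{IL} \vdash N(A) \leftrightarrow B$; and (2) does not act as the identity on $\mathsf{NF}$ in $\mathsf{IL}$, i.e. there is $A \in \mathsf{NF}$ with $\mathsf{IL} \nvdash N(A) \leftrightarrow A$.
   Context: $\mathsf{CL}$ is pure first-order classical predicate logic based on $\bot, \wedge, \vee, \to, \forall, \exists$ (with $\neg A :\equiv A\to\bot$); $\mathsf{IL}$ is its intuitionistic counterpart. $A^G$ is the Gödel–Gentzen translation: $P^G :\equiv \neg\neg P$ for atomic $P \not\equiv \bot$; $\bot^G :\equiv \bot$; $(A\wedge B)^G :\equiv A^G\wedge B^G$; $(A\vee B)^G :\equiv \neg(\neg A^G\wedge\neg B^G)$; $(A\to B)^G :\equiv A^G\to B^G$; $(\forall xA)^G :\equiv \forall x A^G$; $(\exists xA)^G :\equiv \neg\forall x\neg A^G$. $A^G[F/\bot]$ is $A^G$ with every occurrence of $\bot$ replaced by $F$. The negative fragment $\mathsf{NF}$ is inductively generated by: $\bot\in\mathsf{NF}$; $\neg P \in \mathsf{NF}$ for atomic $P$; if $A,B\in\mathsf{NF}$ then $A\wedge B, A\to B, \forall x A \in \mathsf{NF}$. -}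

module Defs where

open import Data.Nat using (ℕ; zero; suc)
open import Data.List using (List; []; _∷_; map)
open import Data.List.Membership.Propositional using (_∈_)
open import Relation.Binary.PropositionalEquality using (_≡_)
open import Relation.Nullary using (¬_)
open import Data.Product using (Σ; _×_)

-- Syntax of pure first-order predicate logic (de Bruijn variables).
-- Terms are variables (pure predicate logic: no function symbols).

Var : Set
Var = ℕ

infixr 6 _∧̇_
infixr 5 _∨̇_
infixr 4 _⇒_
infix  3 _⇔_

data Fm : Set where
  atom : ℕ → List Var → Fm
  ⊥̇    : Fm
  _∧̇_  : Fm → Fm → Fm
  _∨̇_  : Fm → Fm → Fm
  _⇒_  : Fm → Fm → Fm
  ∀̇    : Fm → Fm
  ∃̇    : Fm → Fm

¬̇_ : Fm → Fm
¬̇ A = A ⇒ ⊥̇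

_⇔_ : Fm → Fm → Fm
A ⇔ B = (A ⇒ B) ∧̇ (B ⇒ A)

lift : (Var → Var) → Var → Var
lift ρ zero    = zero
lift ρ (suc n) = suc (ρ n)

ren : (Var → Var) → Fm → Fm
ren ρ (atom p xs) = atom p (map ρ xs)
ren ρ ⊥̇           = ⊥̇
ren ρ (A ∧̇ B)     = ren ρ A ∧̇ ren ρ B
ren ρ (A ∨̇ B)     = ren ρ A ∨̇ ren ρ B
ren ρ (A ⇒ B)     = ren ρ A ⇒ ren ρ B
ren ρ (∀̇ A)       = ∀̇ (ren (lift ρ) A)
ren ρ (∃̇ A)       = ∃̇ (ren (lift ρ) A)

shift : Fm → Fm
shift = ren suc

-- A[t/0] : instantiate the outermost bound variable by variable t
inst0 : Var → Var → Var
inst0 t zero    = t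
inst0 t (suc n) = n

inst : Var → Fm → Fm
inst t = ren (inst0 t)

data Logic : Set where
  classical intuitionistic : Logic

infix 2 _⊢[_]_

data _⊢[_]_ (Γ : List Fm) (L : Logic) : Fm → Set where
  hyp  : ∀ {A} → A ∈ Γ → Γ ⊢[ L ] A
  ⊥E   : ∀ {A} → Γ ⊢[ L ] ⊥̇ → Γ ⊢[ L ] A
  ∧I   : ∀ {A B} → Γ ⊢[ L ] A → Γ ⊢[ L ] B → Γ ⊢[ L ] A ∧̇ B
  ∧E₁  : ∀ {A B} → Γ ⊢[ L ] A ∧̇ B → Γ ⊢[ L ] A
  ∧E₂  : ∀ {A B} → Γ ⊢[ L ] A ∧̇ B → Γ ⊢[ L ] B
  ∨I₁  : ∀ {A B} → Γ ⊢[ L ] A → Γ ⊢[ L ] A ∨̇ B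
  ∨I₂  : ∀ {A B} → Γ ⊢[ L ] B → Γ ⊢[ L ] A ∨̇ B
  ∨E   : ∀ {A B C} → Γ ⊢[ L ] A ∨̇ B → (A ∷ Γ) ⊢[ L ] C → (B ∷ Γ) ⊢[ L ] C
         → Γ ⊢[ L ] C
  ⇒I   : ∀ {A B} → (A ∷ Γ) ⊢[ L ] B → Γ ⊢[ L ] A ⇒ B
  ⇒E   : ∀ {A B} → Γ ⊢[ L ] A ⇒ B → Γ ⊢[ L ] A → Γ ⊢[ L ] B
  ∀I   : ∀ {A} → map shift Γ ⊢[ L ] A → Γ ⊢[ L ] ∀̇ A
  ∀E   : ∀ {A} (t : Var) → Γ ⊢[ L ] ∀̇ A → Γ ⊢[ L ] inst t A
  ∃I   : ∀ {A} (t : Var) → Γ ⊢[ L ] inst t A → Γ ⊢[ L ] ∃̇ A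
  ∃E   : ∀ {A C} → Γ ⊢[ L ] ∃̇ A → (A ∷ map shift Γ) ⊢[ L ] shift C
         → Γ ⊢[ L ] C
  dne  : ∀ {A} → L ≡ classical → Γ ⊢[ L ] ¬̇ ¬̇ A → Γ ⊢[ L ] A

CL⊢_ : Fm → Set
CL⊢ A = [] ⊢[ classical ] A

IL⊢_ : Fm → Set
IL⊢ A = [] ⊢[ intuitionistic ] A

_ᴳ : Fm → Fm
atom p xs ᴳ = ¬̇ ¬̇ atom p xs
⊥̇ ᴳ         = ⊥̇
(A ∧̇ B) ᴳ   = A ᴳ ∧̇ B ᴳ
(A ∨̇ B) ᴳ   = ¬̇ (¬̇ (A ᴳ) ∧̇ ¬̇ (B ᴳ))
(A ⇒ B) ᴳ   = A ᴳ ⇒ B ᴳ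
(∀̇ A) ᴳ     = ∀̇ (A ᴳ)
(∃̇ A) ᴳ     = ¬̇ ∀̇ (¬̇ (A ᴳ))

-- A[F/⊥] : replace every occurrence of ⊥ by F (capture-avoiding:
-- F is shifted when passing under a binder)
_[_/⊥] : Fm → Fm → Fm
atom p xs [ F /⊥] = atom p xs
⊥̇ [ F /⊥]         = F
(A ∧̇ B) [ F /⊥]   = A [ F /⊥] ∧̇ B [ F /⊥]
(A ∨̇ B) [ F /⊥]   = A [ F /⊥] ∨̇ B [ F /⊥]
(A ⇒ B) [ F /⊥]   = A [ F /⊥] ⇒ B [ F /⊥]
∀̇ A [ F /⊥]       = ∀̇ (A [ shift F /⊥])
∃̇ A [ F /⊥]       = ∃̇ (A [ shift F /⊥])

data NF : Fm → Set where
  nf⊥   : NF ⊥̇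
  nf¬P  : ∀ p xs → NF (¬̇ atom p xs)
  nf∧   : ∀ {A B} → NF A → NF B → NF (A ∧̇ B)
  nf⇒   : ∀ {A B} → NF A → NF B → NF (A ⇒ B)
  nf∀   : ∀ {A} → NF A → NF (∀̇ A)

N₁ : Fm → Fm → Fm
N₁ F A = A ᴳ ∨̇ F

N₂ : Fm → Fm → Fm
N₂ F A = (A ᴳ) [ F /⊥]

NotIntoNF : (Fm → Fm) → Set
NotIntoNF N = Σ Fm λ A → (B : Fm) → NF B → ¬ (IL⊢ (N A ⇔ B))

NotIdOnNF : (Fm → Fm) → Set
NotIdOnNF N = Σ Fm λ A → NF A × ¬ (IL⊢ (N A ⇔ A))

-- Both translations send ⊥ to a formula IL-equivalent to F. A formula in NF is IL-equivalent
-- to its Gödel–Gentzen translation, so by soundness of the translation CL is conservative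
-- over IL for NF formulas. If N(⊥) were IL-equivalent to some B ∈ NF, then ¬B ∈ NF would
-- be provable in CL (as ¬F is), hence in IL, giving IL ⊢ ¬F; and IL ⊢ N(⊥) ↔ ⊥ is IL ⊢ ¬F.
module Submission where

open import Defs
open import Data.Product using (_×_; _,_)
open import Relation.Nullary using (¬_)
open import Data.Nat using (suc)
open import Data.List using (List; []; _∷_; map)
open import Data.List.Properties using (map-∘; map-cong; map-id)
open import Data.List.Membership.Propositional.Properties using (∈-map⁺)
open import Data.List.Relation.Binary.Subset.Propositional using (_⊆_)
open import Data.List.Relation.Binary.Subset.Propositional.Properties
  using (map⁺; ∷⁺ʳ; xs⊆x∷xs)
open import Data.List.Relation.Unary.Any using (here; there)
open import Relation.Binary.PropositionalEquality using (_≡_; refl; sym; trans; cong; cong₂; subst)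

private
  variable
    Γ Δ : List Fm
    L : Logic
    A A′ B B′ C : Fm

lift-inverseˡ : (σ ρ : Var → Var) → (∀ x → σ (ρ x) ≡ x) → ∀ x → lift σ (lift ρ x) ≡ x
lift-inverseˡ σ ρ σρ≡id 0       = refl
lift-inverseˡ σ ρ σρ≡id (suc x) = cong suc (σρ≡id x)

ren-inverseˡ : (σ ρ : Var → Var) → (∀ x → σ (ρ x) ≡ x) → ∀ A → ren σ (ren ρ A) ≡ A
ren-inverseˡ σ ρ σρ≡id (atom p xs) =
  cong (atom p) (trans (sym (map-∘ xs)) (trans (map-cong σρ≡id xs) (map-id xs)))
ren-inverseˡ σ ρ σρ≡id ⊥̇       = refl
ren-inverseˡ σ ρ σρ≡id (A ∧̇ B) = cong₂ _∧̇_ (ren-inverseˡ σ ρ σρ≡id A) (ren-inverseˡ σ ρ σρ≡id B)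
ren-inverseˡ σ ρ σρ≡id (A ∨̇ B) = cong₂ _∨̇_ (ren-inverseˡ σ ρ σρ≡id A) (ren-inverseˡ σ ρ σρ≡id B)
ren-inverseˡ σ ρ σρ≡id (A ⇒ B) = cong₂ _⇒_ (ren-inverseˡ σ ρ σρ≡id A) (ren-inverseˡ σ ρ σρ≡id B)
ren-inverseˡ σ ρ σρ≡id (∀̇ A)   = cong ∀̇ (ren-inverseˡ (lift σ) (lift ρ) (lift-inverseˡ σ ρ σρ≡id) A)
ren-inverseˡ σ ρ σρ≡id (∃̇ A)   = cong ∃̇ (ren-inverseˡ (lift σ) (lift ρ) (lift-inverseˡ σ ρ σρ≡id) A)

inst-0-ren-lift-suc : ∀ A → inst 0 (ren (lift suc) A) ≡ A
inst-0-ren-lift-suc = ren-inverseˡ (inst0 0) (lift suc) inst0-lift-suc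
  where
  inst0-lift-suc : ∀ x → inst0 0 (lift suc x) ≡ x
  inst0-lift-suc 0       = refl
  inst0-lift-suc (suc x) = refl

ren-ᴳ : (ρ : Var → Var) → ∀ A → ren ρ (A ᴳ) ≡ (ren ρ A) ᴳ
ren-ᴳ ρ (atom p xs) = refl
ren-ᴳ ρ ⊥̇           = refl
ren-ᴳ ρ (A ∧̇ B)     = cong₂ _∧̇_ (ren-ᴳ ρ A) (ren-ᴳ ρ B)
ren-ᴳ ρ (A ∨̇ B)     = cong₂ (λ X Y → ¬̇ (¬̇ X ∧̇ ¬̇ Y)) (ren-ᴳ ρ A) (ren-ᴳ ρ B)
ren-ᴳ ρ (A ⇒ B)     = cong₂ _⇒_ (ren-ᴳ ρ A) (ren-ᴳ ρ B)
ren-ᴳ ρ (∀̇ A)       = cong ∀̇ (ren-ᴳ (lift ρ) A)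
ren-ᴳ ρ (∃̇ A)       = cong (λ X → ¬̇ ∀̇ (¬̇ X)) (ren-ᴳ (lift ρ) A)

map-ᴳ-shift : ∀ Γ → map _ᴳ (map shift Γ) ≡ map shift (map _ᴳ Γ)
map-ᴳ-shift Γ =
  trans (sym (map-∘ Γ)) (trans (map-cong (λ A → sym (ren-ᴳ suc A)) Γ) (map-∘ Γ))

weaken : Γ ⊆ Δ → Γ ⊢[ L ] A → Δ ⊢[ L ] A
weaken Γ⊆Δ (hyp A∈Γ)  = hyp (Γ⊆Δ A∈Γ)
weaken Γ⊆Δ (⊥E d)     = ⊥E (weaken Γ⊆Δ d)
weaken Γ⊆Δ (∧I d e)   = ∧I (weaken Γ⊆Δ d) (weaken Γ⊆Δ e)
weaken Γ⊆Δ (∧E₁ d)    = ∧E₁ (weaken Γ⊆Δ d)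
weaken Γ⊆Δ (∧E₂ d)    = ∧E₂ (weaken Γ⊆Δ d)
weaken Γ⊆Δ (∨I₁ d)    = ∨I₁ (weaken Γ⊆Δ d)
weaken Γ⊆Δ (∨I₂ d)    = ∨I₂ (weaken Γ⊆Δ d)
weaken Γ⊆Δ (∨E d e f) = ∨E (weaken Γ⊆Δ d) (weaken (∷⁺ʳ _ Γ⊆Δ) e) (weaken (∷⁺ʳ _ Γ⊆Δ) f)
weaken Γ⊆Δ (⇒I d)     = ⇒I (weaken (∷⁺ʳ _ Γ⊆Δ) d)
weaken Γ⊆Δ (⇒E d e)   = ⇒E (weaken Γ⊆Δ d) (weaken Γ⊆Δ e)
weaken Γ⊆Δ (∀I d)     = ∀I (weaken (map⁺ shift Γ⊆Δ) d)
weaken Γ⊆Δ (∀E t d)   = ∀E t (weaken Γ⊆Δ d)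
weaken Γ⊆Δ (∃I t d)   = ∃I t (weaken Γ⊆Δ d)
weaken Γ⊆Δ (∃E d e)   = ∃E (weaken Γ⊆Δ d) (weaken (∷⁺ʳ _ (map⁺ shift Γ⊆Δ)) e)
weaken Γ⊆Δ (dne c d)  = dne c (weaken Γ⊆Δ d)

weaken-∷ : Γ ⊢[ L ] A → (B ∷ Γ) ⊢[ L ] A
weaken-∷ = weaken (xs⊆x∷xs _ _)

weaken-under : (A ∷ Γ) ⊢[ L ] C → (A ∷ B ∷ Γ) ⊢[ L ] C
weaken-under = weaken (∷⁺ʳ _ (xs⊆x∷xs _ _))

apply : [] ⊢[ L ] A ⇒ B → Γ ⊢[ L ] A → Γ ⊢[ L ] B
apply f = ⇒E (weaken (λ ()) f)

hyp₀ : (A ∷ Γ) ⊢[ L ] A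
hyp₀ = hyp (here refl)

hyp₁ : (B ∷ A ∷ Γ) ⊢[ L ] A
hyp₁ = hyp (there (here refl))

hyp₂ : (C ∷ B ∷ A ∷ Γ) ⊢[ L ] A
hyp₂ = hyp (there (there (here refl)))

∀E-shift : Γ ⊢[ L ] shift (∀̇ A) → Γ ⊢[ L ] A
∀E-shift {A = A} d = subst (_ ⊢[ _ ]_) (inst-0-ren-lift-suc A) (∀E 0 d)

IL⇒CL : Γ ⊢[ intuitionistic ] A → Γ ⊢[ classical ] A
IL⇒CL (hyp A∈Γ)  = hyp A∈Γ
IL⇒CL (⊥E d)     = ⊥E (IL⇒CL d)
IL⇒CL (∧I d e)   = ∧I (IL⇒CL d) (IL⇒CL e)
IL⇒CL (∧E₁ d)    = ∧E₁ (IL⇒CL d)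
IL⇒CL (∧E₂ d)    = ∧E₂ (IL⇒CL d)
IL⇒CL (∨I₁ d)    = ∨I₁ (IL⇒CL d)
IL⇒CL (∨I₂ d)    = ∨I₂ (IL⇒CL d)
IL⇒CL (∨E d e f) = ∨E (IL⇒CL d) (IL⇒CL e) (IL⇒CL f)
IL⇒CL (⇒I d)     = ⇒I (IL⇒CL d)
IL⇒CL (⇒E d e)   = ⇒E (IL⇒CL d) (IL⇒CL e)
IL⇒CL (∀I d)     = ∀I (IL⇒CL d)
IL⇒CL (∀E t d)   = ∀E t (IL⇒CL d)
IL⇒CL (∃I t d)   = ∃I t (IL⇒CL d)
IL⇒CL (∃E d e)   = ∃E (IL⇒CL d) (IL⇒CL e)
IL⇒CL (dne () d)

⇒-trans : Γ ⊢[ L ] A ⇒ B → Γ ⊢[ L ] B ⇒ C → Γ ⊢[ L ] A ⇒ C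
⇒-trans f g = ⇒I (⇒E (weaken-∷ g) (⇒E (weaken-∷ f) hyp₀))

⇔-refl : Γ ⊢[ L ] A ⇔ A
⇔-refl = ∧I (⇒I hyp₀) (⇒I hyp₀)

⇔-sym : Γ ⊢[ L ] A ⇔ B → Γ ⊢[ L ] B ⇔ A
⇔-sym e = ∧I (∧E₂ e) (∧E₁ e)

⇔-trans : Γ ⊢[ L ] A ⇔ B → Γ ⊢[ L ] B ⇔ C → Γ ⊢[ L ] A ⇔ C
⇔-trans e e′ = ∧I (⇒-trans (∧E₁ e) (∧E₁ e′)) (⇒-trans (∧E₂ e′) (∧E₂ e))

∧-mono : [] ⊢[ L ] A ⇒ A′ → [] ⊢[ L ] B ⇒ B′ → [] ⊢[ L ] A ∧̇ B ⇒ A′ ∧̇ B′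
∧-mono f g = ⇒I (∧I (apply f (∧E₁ hyp₀)) (apply g (∧E₂ hyp₀)))

⇒-mono : [] ⊢[ L ] A′ ⇒ A → [] ⊢[ L ] B ⇒ B′ → [] ⊢[ L ] (A ⇒ B) ⇒ (A′ ⇒ B′)
⇒-mono f g = ⇒I (⇒I (apply g (⇒E hyp₁ (apply f hyp₀))))

∀-mono : [] ⊢[ L ] A ⇒ B → [] ⊢[ L ] ∀̇ A ⇒ ∀̇ B
∀-mono f = ⇒I (∀I (apply f (∀E-shift hyp₀)))

¬¬-mono : [] ⊢[ L ] A ⇒ B → [] ⊢[ L ] ¬̇ ¬̇ A ⇒ ¬̇ ¬̇ B
¬¬-mono f = ⇒I (⇒I (⇒E hyp₁ (⇒I (⇒E hyp₁ (apply f hyp₀)))))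

∧-cong : [] ⊢[ L ] A ⇔ A′ → [] ⊢[ L ] B ⇔ B′ → [] ⊢[ L ] A ∧̇ B ⇔ A′ ∧̇ B′
∧-cong e e′ = ∧I (∧-mono (∧E₁ e) (∧E₁ e′)) (∧-mono (∧E₂ e) (∧E₂ e′))

⇒-cong : [] ⊢[ L ] A ⇔ A′ → [] ⊢[ L ] B ⇔ B′ → [] ⊢[ L ] (A ⇒ B) ⇔ (A′ ⇒ B′)
⇒-cong e e′ = ∧I (⇒-mono (∧E₂ e) (∧E₁ e′)) (⇒-mono (∧E₁ e) (∧E₂ e′))

¬-cong : [] ⊢[ L ] A ⇔ B → [] ⊢[ L ] ¬̇ A ⇔ ¬̇ B
¬-cong e = ⇒-cong e ⇔-refl

∀-cong : [] ⊢[ L ] A ⇔ B → [] ⊢[ L ] ∀̇ A ⇔ ∀̇ B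
∀-cong e = ∧I (∀-mono (∧E₁ e)) (∀-mono (∧E₂ e))

¬¬-intro : [] ⊢[ L ] A ⇒ ¬̇ ¬̇ A
¬¬-intro = ⇒I (⇒I (⇒E hyp₀ hyp₁))

⊥∨-identity : [] ⊢[ L ] ⊥̇ ∨̇ A ⇔ A
⊥∨-identity = ∧I (⇒I (∨E hyp₀ (⊥E hyp₀) hyp₀)) (⇒I (∨I₂ hyp₀))

Stable : Fm → Set
Stable A = IL⊢ (¬̇ ¬̇ A ⇒ A)

⊥-stable : Stable ⊥̇
⊥-stable = ⇒I (⇒E hyp₀ (⇒I hyp₀))

¬-stable : Stable (¬̇ A)
¬-stable = ⇒I (⇒I (⇒E hyp₁ (⇒I (⇒E hyp₀ hyp₁))))

∧-stable : Stable A → Stable B → Stable (A ∧̇ B)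
∧-stable sA sB = ⇒I (∧I (apply sA (apply (¬¬-mono (⇒I (∧E₁ hyp₀))) hyp₀))
                        (apply sB (apply (¬¬-mono (⇒I (∧E₂ hyp₀))) hyp₀)))

⇒-stable : Stable B → Stable (A ⇒ B)
⇒-stable sB = ⇒I (⇒I (apply sB (⇒I (⇒E hyp₂ (⇒I (⇒E hyp₁ (⇒E hyp₀ hyp₂)))))))

∀-stable : Stable A → Stable (∀̇ A)
∀-stable sA = ⇒I (∀I (apply sA (apply (¬¬-mono (⇒I (∀E-shift hyp₀))) hyp₀)))

ᴳ-stable : ∀ A → Stable (A ᴳ)
ᴳ-stable (atom p xs) = ¬-stable
ᴳ-stable ⊥̇           = ⊥-stable
ᴳ-stable (A ∧̇ B)     = ∧-stable (ᴳ-stable A) (ᴳ-stable B)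
ᴳ-stable (A ∨̇ B)     = ¬-stable
ᴳ-stable (A ⇒ B)     = ⇒-stable (ᴳ-stable B)
ᴳ-stable (∀̇ A)       = ∀-stable (ᴳ-stable A)
ᴳ-stable (∃̇ A)       = ¬-stable

ᴳ-sound : Γ ⊢[ classical ] A → map _ᴳ Γ ⊢[ intuitionistic ] A ᴳ
ᴳ-sound (hyp A∈Γ)  = hyp (∈-map⁺ _ᴳ A∈Γ)
ᴳ-sound (⊥E d)     = ⊥E (ᴳ-sound d)
ᴳ-sound (∧I d e)   = ∧I (ᴳ-sound d) (ᴳ-sound e)
ᴳ-sound (∧E₁ d)    = ∧E₁ (ᴳ-sound d)
ᴳ-sound (∧E₂ d)    = ∧E₂ (ᴳ-sound d)
ᴳ-sound (∨I₁ d)    = ⇒I (⇒E (∧E₁ hyp₀) (weaken-∷ (ᴳ-sound d)))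
ᴳ-sound (∨I₂ d)    = ⇒I (⇒E (∧E₂ hyp₀) (weaken-∷ (ᴳ-sound d)))
ᴳ-sound {A = C} (∨E d e f) =
  apply (ᴳ-stable C) (⇒I (⇒E (weaken-∷ (ᴳ-sound d))
    (∧I (⇒I (⇒E hyp₁ (weaken-under (ᴳ-sound e))))
        (⇒I (⇒E hyp₁ (weaken-under (ᴳ-sound f)))))))
ᴳ-sound (⇒I d)     = ⇒I (ᴳ-sound d)
ᴳ-sound (⇒E d e)   = ⇒E (ᴳ-sound d) (ᴳ-sound e)
ᴳ-sound {Γ} (∀I d) = ∀I (subst (_⊢[ _ ] _) (map-ᴳ-shift Γ) (ᴳ-sound d))
ᴳ-sound (∀E {A} t d) = subst (_ ⊢[ _ ]_) (ren-ᴳ (inst0 t) A) (∀E t (ᴳ-sound d))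
ᴳ-sound (∃I {A} t d) =
  ⇒I (⇒E (∀E t hyp₀) (weaken-∷ (subst (_ ⊢[ _ ]_) (sym (ren-ᴳ (inst0 t) A)) (ᴳ-sound d))))
ᴳ-sound {Γ} {C} (∃E {A} d e) =
  apply (ᴳ-stable C) (⇒I (⇒E (weaken-∷ (ᴳ-sound d)) (∀I (⇒I (⇒E hyp₁ (weaken-under e′))))))
  where
  e′ : (A ᴳ ∷ map shift (map _ᴳ Γ)) ⊢[ intuitionistic ] shift (C ᴳ)
  e′ = subst (_ ⊢[ _ ]_) (sym (ren-ᴳ suc C))
         (subst (_⊢[ intuitionistic ] (shift C) ᴳ) (cong (A ᴳ ∷_) (map-ᴳ-shift Γ)) (ᴳ-sound e))
ᴳ-sound (dne _ d)  = apply (ᴳ-stable _) (ᴳ-sound d)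

NF-ᴳ : NF A → IL⊢ (A ᴳ ⇔ A)
NF-ᴳ nf⊥          = ⇔-refl
NF-ᴳ (nf¬P p xs)  = ∧I ¬-stable ¬¬-intro
NF-ᴳ (nf∧ nA nB)  = ∧-cong (NF-ᴳ nA) (NF-ᴳ nB)
NF-ᴳ (nf⇒ nA nB)  = ⇒-cong (NF-ᴳ nA) (NF-ᴳ nB)
NF-ᴳ (nf∀ nA)     = ∀-cong (NF-ᴳ nA)

NF-conservative : NF A → CL⊢ A → IL⊢ A
NF-conservative nA d = apply (∧E₁ (NF-ᴳ nA)) (ᴳ-sound d)

⇔NF-conservative : NF B → IL⊢ (A ⇔ B) → CL⊢ A → IL⊢ A
⇔NF-conservative nB e d = apply (∧E₂ e) (NF-conservative nB (apply (IL⇒CL (∧E₁ e)) d))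

module _ {N : Fm → Fm} {F : Fm} (N⊥⇔F : IL⊢ (N ⊥̇ ⇔ F)) (IL⊬¬F : ¬ (IL⊢ (¬̇ F))) where

  notIntoNF : CL⊢ (¬̇ F) → NotIntoNF N
  notIntoNF CL⊢¬F = ⊥̇ , λ B nB N⊥⇔B →
    IL⊬¬F (⇔NF-conservative (nf⇒ nB nf⊥) (¬-cong (⇔-trans (⇔-sym N⊥⇔F) N⊥⇔B)) CL⊢¬F)

  notIdOnNF : NotIdOnNF N
  notIdOnNF = ⊥̇ , nf⊥ , λ N⊥⇔⊥ → IL⊬¬F (∧E₁ (⇔-trans (⇔-sym N⊥⇔F) N⊥⇔⊥))

proposition3 : (F : Fm) → CL⊢ (¬̇ F) → ¬ (IL⊢ (¬̇ F))
    → (NotIntoNF (N₁ F) × NotIdOnNF (N₁ F)) × (NotIntoNF (N₂ F) × NotIdOnNF (N₂ F))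
proposition3 F CL⊢¬F IL⊬¬F =
    (notIntoNF ⊥∨-identity IL⊬¬F CL⊢¬F , notIdOnNF ⊥∨-identity IL⊬¬F)
  , (notIntoNF ⇔-refl IL⊬¬F CL⊢¬F , notIdOnNF ⇔-refl IL⊬¬F)
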